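{- For any index set $I$ and any family $\mathbf{T}=(T_i)_{i\in I}$ of $\mathcal{L}_{\mathrm{PA}}(I)$-theories, the intended structure $\mathscr{M}_{\mathbf{T}}$ interprets formulas by substitution; that is, for every $\mathcal{L}_{\mathrm{PA}}(I)$-formula $\phi$ and assignment $s$, $\mathscr{M}_{\mathbf{T}}\models\phi[s]$ if and only if $\mathscr{M}_{\mathbf{T}}\models\phi^s$.
   Context: Base logic: first-order logic extended by unary operators $\Box$ (formulas $\Box\phi$, $\mathrm{FV}(\Box\phi)=\mathrm{FV}(\phi)$); a structure additionally assigns a truth value $\mathscr{M}\models\Box\phi[s]$ to each operator, formula and assignment, independent of $s(x)$ for $x\notin\mathrm{FV}(\phi)$, invariant under alphabetic variants, and respecting variable substitution; satisfaction is extended inductively. $\mathcal{L}_{\mathrm{PA}}(I)$ is the language of arithmetic ($0,S,+,\cdot$) plus operators $\Box_i$, $i\in I$. Numerals: $\overline{0}=0$, $\overline{n+1}=S(\overline{n})$. For $\phi$ with $\mathrm{FV}(\phi)=\{x_1,\dots,x_n\}$ and assignment $s$ into $\mathbb{N}$, $\phi^s=\phi(x_1|\overline{s(x_1)})\cdots(x_n|\overline{s(x_n)})$. The intended structure $\mathscr{M}_{\mathbf{T}}$ has universe $\mathbb{N}$, standard interpretation of $0,S,+,\cdot$, and $\mathscr{M}_{\mathbf{T}}\models\Box_i\phi[s]$ iff $T_i\models\phi^s$. A structure interprets formulas by substitution if it has universe $\mathbb{N}$ with standard arithmetic and satisfies $\phi[s]$ iff it satisfies $\phi^s$, for all $\phi,s$.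 -}

module Defs where

open import Level using (Level; 0ℓ; Lift; _⊔_) renaming (suc to lsuc)
open import Data.Nat using (ℕ; zero; suc; _≡ᵇ_)
open import Data.Bool using (Bool; true; false; if_then_else_)
open import Data.List using (List; []; _∷_; _++_; foldl)
open import Data.List.Membership.Propositional using (_∈_; _∉_)
open import Data.Product using (_×_; _,_)
open import Data.Sum using (_⊎_)
open import Data.Empty using (⊥)
open import Data.Unit using (⊤)
open import Relation.Binary.PropositionalEquality using (_≡_; _≢_)
open import Function.Bundles using (_⇔_)

Var : Set
Var = ℕ

data Term : Set where
  var   : Var → Term
  zro   : Term
  succ  : Term → Term
  plus  : Term → Term → Term
  times : Term → Term → Term

data Formula (I : Set) : Set where
  _≐_ : Term → Term → Formula I
  ¬'  : Formula I → Formula I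
  _⇒_ : Formula I → Formula I → Formula I
  ∀'  : Var → Formula I → Formula I
  □   : I → Formula I → Formula I

tvars : Term → List Var
tvars (var x) = x ∷ []
tvars zro = []
tvars (succ t) = tvars t
tvars (plus t u) = tvars t ++ tvars u
tvars (times t u) = tvars t ++ tvars u

remove : Var → List Var → List Var
remove x [] = []
remove x (y ∷ ys) = if x ≡ᵇ y then remove x ys else y ∷ remove x ys

fv : {I : Set} → Formula I → List Var
fv (t ≐ u) = tvars t ++ tvars u
fv (¬' φ) = fv φ
fv (φ ⇒ ψ) = fv φ ++ fv ψ
fv (∀' x φ) = remove x (fv φ)
fv (□ i φ) = fv φ

-- substitution φ(x|t) (Enderton: no renaming; into the scope of □ as well)
tsub : Term → Var → Term → Term
tsub (var y) x t = if x ≡ᵇ y then t else var y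
tsub zro x t = zro
tsub (succ u) x t = succ (tsub u x t)
tsub (plus u v) x t = plus (tsub u x t) (tsub v x t)
tsub (times u v) x t = times (tsub u x t) (tsub v x t)

_[_∣_] : {I : Set} → Formula I → Var → Term → Formula I
(u ≐ v) [ x ∣ t ] = tsub u x t ≐ tsub v x t
(¬' φ) [ x ∣ t ] = ¬' (φ [ x ∣ t ])
(φ ⇒ ψ) [ x ∣ t ] = (φ [ x ∣ t ]) ⇒ (ψ [ x ∣ t ])
(∀' y φ) [ x ∣ t ] = if x ≡ᵇ y then ∀' y φ else ∀' y (φ [ x ∣ t ])
(□ i φ) [ x ∣ t ] = □ i (φ [ x ∣ t ])

Substitutable : {I : Set} → Term → Var → Formula I → Set
Substitutable t x (u ≐ v) = ⊤
Substitutable t x (¬' φ) = Substitutable t x φ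
Substitutable t x (φ ⇒ ψ) = Substitutable t x φ × Substitutable t x ψ
Substitutable t x (∀' y φ) =
  (x ∉ fv (∀' y φ)) ⊎ ((y ∉ tvars t) × Substitutable t x φ)
Substitutable t x (□ i φ) = Substitutable t x φ

VarRel : List (Var × Var) → Var → Var → Set
VarRel [] x y = x ≡ y
VarRel ((a , b) ∷ Γ) x y = (x ≡ a × y ≡ b) ⊎ (x ≢ a × y ≢ b × VarRel Γ x y)

TermRel : List (Var × Var) → Term → Term → Set
TermRel Γ (var x) (var y) = VarRel Γ x y
TermRel Γ zro zro = ⊤
TermRel Γ (succ t) (succ u) = TermRel Γ t u
TermRel Γ (plus t t') (plus u u') = TermRel Γ t u × TermRel Γ t' u'
TermRel Γ (times t t') (times u u') = TermRel Γ t u × TermRel Γ t' u'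
TermRel Γ _ _ = ⊥

AlphaRel : {I : Set} → List (Var × Var) → Formula I → Formula I → Set
AlphaRel Γ (t ≐ t') (u ≐ u') = TermRel Γ t u × TermRel Γ t' u'
AlphaRel Γ (¬' φ) (¬' ψ) = AlphaRel Γ φ ψ
AlphaRel Γ (φ ⇒ φ') (ψ ⇒ ψ') = AlphaRel Γ φ ψ × AlphaRel Γ φ' ψ'
AlphaRel Γ (∀' x φ) (∀' y ψ) = AlphaRel ((x , y) ∷ Γ) φ ψ
AlphaRel Γ (□ i φ) (□ j ψ) = (i ≡ j) × AlphaRel Γ φ ψ
AlphaRel Γ _ _ = ⊥

AlphabeticVariant : {I : Set} → Formula I → Formula I → Set
AlphabeticVariant φ ψ = AlphaRel [] φ ψ

record PreStructure (I : Set) (ℓ : Level) : Set (lsuc ℓ) where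
  field
    D     : Set
    z     : D
    sc    : D → D
    pl    : D → D → D
    tm    : D → D → D
    box   : I → Formula I → (Var → D) → Set ℓ

module _ {I : Set} {ℓ : Level} (M : PreStructure I ℓ) where
  open PreStructure M

  update : (Var → D) → Var → D → (Var → D)
  update s x d y = if x ≡ᵇ y then d else s y

  eval : (Var → D) → Term → D
  eval s (var x) = s x
  eval s zro = z
  eval s (succ t) = sc (eval s t)
  eval s (plus t u) = pl (eval s t) (eval s u)
  eval s (times t u) = tm (eval s t) (eval s u)

  Sat : Formula I → (Var → D) → Set ℓ
  Sat (t ≐ u) s = Lift ℓ (eval s t ≡ eval s u)
  Sat (¬' φ) s = Sat φ s → ⊥
  Sat (φ ⇒ ψ) s = Sat φ s → Sat ψ s
  Sat (∀' x φ) s = (d : D) → Sat φ (update s x d)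
  Sat (□ i φ) s = box i φ s

  record IsStructure : Set (lsuc ℓ) where
    field
      independent : ∀ i φ (s s' : Var → D) →
        (∀ x → x ∈ fv φ → s x ≡ s' x) → (box i φ s ⇔ box i φ s')
      alphaInvariant : ∀ i φ ψ (s : Var → D) →
        AlphabeticVariant φ ψ → (box i φ s ⇔ box i ψ s)
      respectsSubst : ∀ i φ (x y : Var) (s : Var → D) →
        Substitutable (var y) x φ →
        (box i (φ [ x ∣ var y ]) s ⇔ box i φ (update s x (s y)))

Theory : Set → Set₁
Theory I = Formula I → Set

_⊨_ : {I : Set} → Theory I → Formula I → Set₁
_⊨_ {I} T φ = (M : PreStructure I 0ℓ) → IsStructure M →
  (s : Var → PreStructure.D M) → (∀ ψ → T ψ → Sat M ψ s) → Sat M φ s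

num : ℕ → Term
num zero = zro
num (suc n) = succ (num n)

_^_ : {I : Set} → Formula I → (Var → ℕ) → Formula I
φ ^ s = foldl (λ ψ x → ψ [ x ∣ num (s x) ]) φ (fv φ)

stdStructure : {I : Set} {ℓ : Level} → (I → Formula I → (Var → ℕ) → Set ℓ) →
  PreStructure I ℓ
stdStructure b = record
  { D = ℕ ; z = zero ; sc = suc ; pl = Data.Nat._+_ ; tm = Data.Nat._*_ ; box = b }


-- interprets formulas by substitution (M ⊨ σ for a sentence σ: every assignment)
InterpretsBySubstitution : {I : Set} {ℓ : Level} →
  (I → Formula I → (Var → ℕ) → Set ℓ) → Set ℓ
InterpretsBySubstitution {I} b =
  (φ : Formula I) (s : Var → ℕ) →
    Sat (stdStructure b) φ s ⇔ ((s' : Var → ℕ) → Sat (stdStructure b) (φ ^ s) s')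

intendedBox : {I : Set} → (I → Theory I) → I → Formula I → (Var → ℕ) → Set₁
intendedBox T i φ s = T i ⊨ (φ ^ s)

intended : {I : Set} → (I → Theory I) → PreStructure I (lsuc 0ℓ)
intended T = stdStructure (intendedBox T)

-- The iterated single substitutions making up φ ^ s amount to one simultaneous
-- substitution of numerals, because numerals are closed. Satisfaction commutes
-- with simultaneous substitution of numerals (the substitution lemma), and for a
-- □-formula this is because the truth of □ᵢφ[s] depends only on φ ^ s, which
-- substitution does not change. Taking the substitution to be s itself gives
-- 𝓜 ⊨ φ ^ s [s'] ⇔ 𝓜 ⊨ φ [s] for every s'.
module Submission where

open import Defs
open import Level using (Level; lift)
open import Data.Nat using (ℕ; zero; suc; _≡ᵇ_; _+_; _*_)
open import Data.Nat.Properties using (≡ᵇ⇒≡)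
open import Data.Bool using (true; false; if_then_else_; T)
open import Data.Maybe using (Maybe; just; nothing; maybe′; fromMaybe; _<∣>_)
open import Data.List using (List; []; _∷_; foldl)
open import Data.List.Membership.Propositional using (_∈_)
open import Data.List.Membership.Propositional.Properties using (∈-++⁺ˡ; ∈-++⁺ʳ)
open import Data.List.Relation.Unary.Any using (here; there)
open import Data.Unit using (tt)
open import Relation.Binary.PropositionalEquality
open import Function using (_∘_)
open import Function.Bundles using (_⇔_; mk⇔; Equivalence)
open import Function.Construct.Identity using (⇔-id)
open Equivalence

≡ᵇ-refl : ∀ n → (n ≡ᵇ n) ≡ true
≡ᵇ-refl zero = refl
≡ᵇ-refl (suc n) = ≡ᵇ-refl n

≡ᵇ-true⇒≡ : ∀ m n → (m ≡ᵇ n) ≡ true → m ≡ n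
≡ᵇ-true⇒≡ m n e = ≡ᵇ⇒≡ m n (subst T (sym e) tt)

∈-remove : ∀ x y ys → (x ≡ᵇ y) ≡ false → y ∈ ys → y ∈ remove x ys
∈-remove x y (w ∷ ws) e (here refl) rewrite e = here refl
∈-remove x y (w ∷ ws) e (there p) with x ≡ᵇ w
... | true = ∈-remove x y ws e p
... | false = there (∈-remove x y ws e p)

NumSubst : Set
NumSubst = Var → Maybe ℕ

∅ : NumSubst
∅ _ = nothing

_↦_ : Var → ℕ → NumSubst
(x ↦ n) y = if x ≡ᵇ y then just n else nothing

_∪_ : NumSubst → NumSubst → NumSubst
(σ ∪ τ) y = σ y <∣> τ y

_∖_ : NumSubst → Var → NumSubst
(σ ∖ x) y = if x ≡ᵇ y then nothing else σ y

substTerm : NumSubst → Term → Term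
substTerm σ (var y) = maybe′ num (var y) (σ y)
substTerm σ zro = zro
substTerm σ (succ t) = succ (substTerm σ t)
substTerm σ (plus t u) = plus (substTerm σ t) (substTerm σ u)
substTerm σ (times t u) = times (substTerm σ t) (substTerm σ u)

substForm : {I : Set} → NumSubst → Formula I → Formula I
substForm σ (t ≐ u) = substTerm σ t ≐ substTerm σ u
substForm σ (¬' φ) = ¬' (substForm σ φ)
substForm σ (φ ⇒ ψ) = substForm σ φ ⇒ substForm σ ψ
substForm σ (∀' x φ) = ∀' x (substForm (σ ∖ x) φ)
substForm σ (□ i φ) = □ i (substForm σ φ)

substTerm-cong : ∀ {σ τ} t → (∀ y → y ∈ tvars t → σ y ≡ τ y) →
  substTerm σ t ≡ substTerm τ t
substTerm-cong (var y) h = cong (λ m → maybe′ num (var y) m) (h y (here refl))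
substTerm-cong zro h = refl
substTerm-cong (succ t) h = cong succ (substTerm-cong t h)
substTerm-cong (plus t u) h = cong₂ plus
  (substTerm-cong t (λ y → h y ∘ ∈-++⁺ˡ))
  (substTerm-cong u (λ y → h y ∘ ∈-++⁺ʳ (tvars t)))
substTerm-cong (times t u) h = cong₂ times
  (substTerm-cong t (λ y → h y ∘ ∈-++⁺ˡ))
  (substTerm-cong u (λ y → h y ∘ ∈-++⁺ʳ (tvars t)))

substForm-cong : ∀ {I} {σ τ} (φ : Formula I) → (∀ y → y ∈ fv φ → σ y ≡ τ y) →
  substForm σ φ ≡ substForm τ φ
substForm-cong (t ≐ u) h = cong₂ _≐_
  (substTerm-cong t (λ y → h y ∘ ∈-++⁺ˡ))
  (substTerm-cong u (λ y → h y ∘ ∈-++⁺ʳ (tvars t)))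
substForm-cong (¬' φ) h = cong ¬' (substForm-cong φ h)
substForm-cong (φ ⇒ ψ) h = cong₂ _⇒_
  (substForm-cong φ (λ y → h y ∘ ∈-++⁺ˡ))
  (substForm-cong ψ (λ y → h y ∘ ∈-++⁺ʳ (fv φ)))
substForm-cong {σ = σ} {τ} (∀' x φ) h = cong (∀' x) (substForm-cong φ agree)
  where
  agree : ∀ y → y ∈ fv φ → (σ ∖ x) y ≡ (τ ∖ x) y
  agree y p with x ≡ᵇ y in e
  ... | true = refl
  ... | false = h y (∈-remove x y (fv φ) e p)
substForm-cong (□ i φ) h = cong (□ i) (substForm-cong φ h)

substForm-cong-∀ : ∀ {I} {σ τ} (φ : Formula I) → (∀ y → σ y ≡ τ y) →
  substForm σ φ ≡ substForm τ φ
substForm-cong-∀ φ h = substForm-cong φ (λ y _ → h y)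

substTerm-id : ∀ {σ} t → (∀ y → σ y ≡ nothing) → substTerm σ t ≡ t
substTerm-id {σ} (var y) h rewrite h y = refl
substTerm-id zro h = refl
substTerm-id (succ t) h = cong succ (substTerm-id t h)
substTerm-id (plus t u) h = cong₂ plus (substTerm-id t h) (substTerm-id u h)
substTerm-id (times t u) h = cong₂ times (substTerm-id t h) (substTerm-id u h)

substForm-id : ∀ {I} {σ} (φ : Formula I) → (∀ y → σ y ≡ nothing) → substForm σ φ ≡ φ
substForm-id (t ≐ u) h = cong₂ _≐_ (substTerm-id t h) (substTerm-id u h)
substForm-id (¬' φ) h = cong ¬' (substForm-id φ h)
substForm-id (φ ⇒ ψ) h = cong₂ _⇒_ (substForm-id φ h) (substForm-id ψ h)
substForm-id {σ = σ} (∀' x φ) h = cong (∀' x) (substForm-id φ empty)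
  where
  empty : ∀ y → (σ ∖ x) y ≡ nothing
  empty y with x ≡ᵇ y
  ... | true = refl
  ... | false = h y
substForm-id (□ i φ) h = cong (□ i) (substForm-id φ h)

substTerm-num : ∀ σ n → substTerm σ (num n) ≡ num n
substTerm-num σ zero = refl
substTerm-num σ (suc n) = cong succ (substTerm-num σ n)

substTerm-∘ : ∀ σ τ t → substTerm τ (substTerm σ t) ≡ substTerm (σ ∪ τ) t
substTerm-∘ σ τ (var y) with σ y
... | just n = substTerm-num τ n
... | nothing = refl
substTerm-∘ σ τ zro = refl
substTerm-∘ σ τ (succ t) = cong succ (substTerm-∘ σ τ t)
substTerm-∘ σ τ (plus t u) = cong₂ plus (substTerm-∘ σ τ t) (substTerm-∘ σ τ u)
substTerm-∘ σ τ (times t u) = cong₂ times (substTerm-∘ σ τ t) (substTerm-∘ σ τ u)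

substForm-∘ : ∀ {I} σ τ (φ : Formula I) →
  substForm τ (substForm σ φ) ≡ substForm (σ ∪ τ) φ
substForm-∘ σ τ (t ≐ u) = cong₂ _≐_ (substTerm-∘ σ τ t) (substTerm-∘ σ τ u)
substForm-∘ σ τ (¬' φ) = cong ¬' (substForm-∘ σ τ φ)
substForm-∘ σ τ (φ ⇒ ψ) = cong₂ _⇒_ (substForm-∘ σ τ φ) (substForm-∘ σ τ ψ)
substForm-∘ σ τ (∀' x φ) =
  cong (∀' x) (trans (substForm-∘ (σ ∖ x) (τ ∖ x) φ) (substForm-cong-∀ φ ∖-distrib-∪))
  where
  ∖-distrib-∪ : ∀ y → ((σ ∖ x) ∪ (τ ∖ x)) y ≡ ((σ ∪ τ) ∖ x) y
  ∖-distrib-∪ y with x ≡ᵇ y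
  ... | true = refl
  ... | false = refl
substForm-∘ σ τ (□ i φ) = cong (□ i) (substForm-∘ σ τ φ)

substTerm-single : ∀ x n t → tsub t x (num n) ≡ substTerm (x ↦ n) t
substTerm-single x n (var y) with x ≡ᵇ y
... | true = refl
... | false = refl
substTerm-single x n zro = refl
substTerm-single x n (succ t) = cong succ (substTerm-single x n t)
substTerm-single x n (plus t u) =
  cong₂ plus (substTerm-single x n t) (substTerm-single x n u)
substTerm-single x n (times t u) =
  cong₂ times (substTerm-single x n t) (substTerm-single x n u)

substForm-single : ∀ {I} x n (φ : Formula I) → φ [ x ∣ num n ] ≡ substForm (x ↦ n) φ
substForm-single x n (t ≐ u) = cong₂ _≐_ (substTerm-single x n t) (substTerm-single x n u)
substForm-single x n (¬' φ) = cong ¬' (substForm-single x n φ)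
substForm-single x n (φ ⇒ ψ) = cong₂ _⇒_ (substForm-single x n φ) (substForm-single x n ψ)
substForm-single x n (∀' z φ) with x ≡ᵇ z in x≡ᵇz
... | true = cong (∀' z) (sym (substForm-id φ bound))
  where
  bound : ∀ y → ((x ↦ n) ∖ z) y ≡ nothing
  bound y rewrite ≡ᵇ-true⇒≡ x z x≡ᵇz with z ≡ᵇ y
  ... | true = refl
  ... | false = refl
... | false = cong (∀' z) (trans (substForm-single x n φ) (substForm-cong-∀ φ free))
  where
  free : ∀ y → (x ↦ n) y ≡ ((x ↦ n) ∖ z) y
  free y with z ≡ᵇ y in z≡ᵇy
  ... | true rewrite sym (≡ᵇ-true⇒≡ z y z≡ᵇy) | x≡ᵇz = refl
  ... | false = refl
substForm-single x n (□ i φ) = cong (□ i) (substForm-single x n φ)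

restrict : (Var → ℕ) → List Var → NumSubst
restrict s [] = ∅
restrict s (x ∷ xs) = (x ↦ s x) ∪ restrict s xs

restrict-∈ : ∀ s xs y → y ∈ xs → restrict s xs y ≡ just (s y)
restrict-∈ s (x ∷ xs) y (here refl) rewrite ≡ᵇ-refl y = refl
restrict-∈ s (x ∷ xs) y (there p) with x ≡ᵇ y in e
... | true rewrite ≡ᵇ-true⇒≡ x y e = refl
... | false = restrict-∈ s xs y p

foldl-substForm-single : ∀ {I} s xs (ψ : Formula I) →
  foldl (λ χ x → χ [ x ∣ num (s x) ]) ψ xs ≡ substForm (restrict s xs) ψ
foldl-substForm-single s [] ψ = sym (substForm-id ψ (λ _ → refl))
foldl-substForm-single s (x ∷ xs) ψ = begin
  foldl (λ χ x → χ [ x ∣ num (s x) ]) (ψ [ x ∣ num (s x) ]) xs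
    ≡⟨ foldl-substForm-single s xs _ ⟩
  substForm (restrict s xs) (ψ [ x ∣ num (s x) ])
    ≡⟨ cong (substForm (restrict s xs)) (substForm-single x (s x) ψ) ⟩
  substForm (restrict s xs) (substForm (x ↦ s x) ψ)
    ≡⟨ substForm-∘ (x ↦ s x) (restrict s xs) ψ ⟩
  substForm (restrict s (x ∷ xs)) ψ
    ∎
  where open ≡-Reasoning

^-as-substForm : ∀ {I} (φ : Formula I) s → φ ^ s ≡ substForm (just ∘ s) φ
^-as-substForm φ s = trans (foldl-substForm-single s (fv φ) φ)
  (substForm-cong φ (restrict-∈ s (fv φ)))

override : (Var → ℕ) → NumSubst → (Var → ℕ)
override s σ y = fromMaybe (s y) (σ y)

substForm-^ : ∀ {I} (φ : Formula I) σ s s' → (∀ y → s' y ≡ override s σ y) →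
  substForm σ φ ^ s ≡ φ ^ s'
substForm-^ φ σ s s' h = begin
  substForm σ φ ^ s                         ≡⟨ ^-as-substForm (substForm σ φ) s ⟩
  substForm (just ∘ s) (substForm σ φ)      ≡⟨ substForm-∘ σ (just ∘ s) φ ⟩
  substForm (σ ∪ (just ∘ s)) φ              ≡⟨ substForm-cong-∀ φ agree ⟩
  substForm (just ∘ s') φ                   ≡⟨ ^-as-substForm φ s' ⟨
  φ ^ s'                                    ∎
  where
  open ≡-Reasoning
  agree : ∀ y → (σ ∪ (just ∘ s)) y ≡ just (s' y)
  agree y rewrite h y with σ y
  ... | just n = refl
  ... | nothing = refl

viaClosure : {I : Set} {ℓ : Level} → (I → Formula I → Set ℓ) →
  I → Formula I → (Var → ℕ) → Set ℓ
viaClosure B i φ s = B i (φ ^ s)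

module _ {I : Set} {ℓ : Level} (B : I → Formula I → Set ℓ) where

  private
    M = stdStructure (viaClosure B)

  eval-num : ∀ s n → eval M s (num n) ≡ n
  eval-num s zero = refl
  eval-num s (suc n) = cong suc (eval-num s n)

  eval-substTerm : ∀ σ s s' t → (∀ y → s' y ≡ override s σ y) →
    eval M s (substTerm σ t) ≡ eval M s' t
  eval-substTerm σ s s' (var y) h with σ y | h y
  ... | just n | e = trans (eval-num s n) (sym e)
  ... | nothing | e = sym e
  eval-substTerm σ s s' zro h = refl
  eval-substTerm σ s s' (succ t) h = cong suc (eval-substTerm σ s s' t h)
  eval-substTerm σ s s' (plus t u) h =
    cong₂ _+_ (eval-substTerm σ s s' t h) (eval-substTerm σ s s' u h)
  eval-substTerm σ s s' (times t u) h =
    cong₂ _*_ (eval-substTerm σ s s' t h) (eval-substTerm σ s s' u h)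

  sat-substForm : ∀ (φ : Formula I) σ s s' → (∀ y → s' y ≡ override s σ y) →
    Sat M (substForm σ φ) s ⇔ Sat M φ s'
  sat-substForm (t ≐ u) σ s s' h = mk⇔
    (λ (lift e) → lift (trans (sym eval-t) (trans e eval-u)))
    (λ (lift e) → lift (trans eval-t (trans e (sym eval-u))))
    where
    eval-t = eval-substTerm σ s s' t h
    eval-u = eval-substTerm σ s s' u h
  sat-substForm (¬' φ) σ s s' h = mk⇔ (λ f → f ∘ from E) (λ f → f ∘ to E)
    where E = sat-substForm φ σ s s' h
  sat-substForm (φ ⇒ ψ) σ s s' h =
    mk⇔ (λ f → to F ∘ f ∘ from E) (λ f → from F ∘ f ∘ to E)
    where
    E = sat-substForm φ σ s s' h
    F = sat-substForm ψ σ s s' h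
  sat-substForm (∀' x φ) σ s s' h =
    mk⇔ (λ f d → to (E d) (f d)) (λ f d → from (E d) (f d))
    where
    E : ∀ d → Sat M (substForm (σ ∖ x) φ) (update M s x d) ⇔ Sat M φ (update M s' x d)
    E d = sat-substForm φ (σ ∖ x) (update M s x d) (update M s' x d) agree
      where
      agree : ∀ y → update M s' x d y ≡ override (update M s x d) (σ ∖ x) y
      agree y with x ≡ᵇ y
      ... | true = refl
      ... | false = h y
  sat-substForm (□ i φ) σ s s' h =
    subst (λ ψ → B i (substForm σ φ ^ s) ⇔ B i ψ) (substForm-^ φ σ s s' h) (⇔-id _)

  sat-^ : ∀ (φ : Formula I) s s' → Sat M (φ ^ s) s' ⇔ Sat M φ s
  sat-^ φ s s' = subst (λ ψ → Sat M ψ s' ⇔ Sat M φ s) (sym (^-as-substForm φ s))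
    (sat-substForm φ (just ∘ s) s' s (λ _ → refl))

  viaClosure-interpretsBySubstitution : InterpretsBySubstitution (viaClosure B)
  viaClosure-interpretsBySubstitution φ s =
    mk⇔ (λ sat s' → from (sat-^ φ s s') sat) (λ sat → to (sat-^ φ s s) (sat s))

lemma2p8 : (I : Set) (T : I → Theory I) → InterpretsBySubstitution (intendedBox T)
lemma2p8 I T = viaClosure-interpretsBySubstitution (λ i ψ → T i ⊨ ψ)
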